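{- Let $V_1,\dots,V_r$ be finite-dimensional vector spaces over a field $k$, and let $(x_{W_0},\dots,x_{W_l})$, $l\ge1$, be a sequence of vertices of $\mathcal{B}(V_1,\dots,V_r)$, each $W_s$ a nonzero proper subspace of some $V_i$. Then it is a geodesic path in $\mathcal{B}(V_1,\dots,V_r)$ if and only if one of the following holds: (1) all $W_s$ lie in a single $V_i$ and $(x_{W_0},\dots,x_{W_l})$ is a geodesic path in $\mathcal{B}(V_i)$; (2) there exist $i\ne j$ such that the $W_s$ lie alternately in $V_i$ and $V_j$, and for every $0\le s\le l-2$: if $W_s\subseteq V_i$ then $W_s\oplus W_{s+2}=V_i$, and if $W_s\subseteq V_j$ then $W_s\oplus W_{s+2}=V_j$.
   Context: $\mathcal{B}(V)$ has vertices $x_W$ for nonzero proper subspaces $W\subseteq V$ and simplices the flags; $x_W,x_{W'}$ are opposite iff $V=W\oplus W'$. $\mathcal{B}(V_1,\dots,V_r)$ is the join of the $\mathcal{B}(V_i)$: vertex set the disjoint union, simplices the unions of one simplex from each factor; two vertices of a join are opposite iff they lie in the same factor and are opposite there. The link of a vertex $x$ consists of simplices $A\not\ni x$ with $A\cup\{x\}$ a simplex; for $W\subseteq V_i$, the link of $x_W$ is identified with the join of the $\mathcal{B}(V_j)$, $j\ne i$, together with $\mathcal{B}(W)$ and $\mathcal{B}(V_i/W)$ (subspaces $W'\subsetneq W$ go to $\mathcal{B}(W)$, $W'\supsetneq W$ to $x_{W'/W}\in\mathcal{B}(V_i/W)$), with join opposition. A path $(x_0,\dots,x_l)$ has $x_s\ne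 x_{s+1}$ and $\{x_s,x_{s+1}\}$ a simplex; it is geodesic if $x_{s-1},x_{s+1}$ are opposite in the link of $x_s$ for $1\le s\le l-1$. -}

module Defs where

open import Level using (Level; _⊔_) renaming (suc to lsuc)
open import Data.Nat using (ℕ; zero; suc)
open import Data.Fin using (Fin; zero; suc; inject₁)
open import Data.Product using (Σ; ∃; _×_; _,_; proj₁; proj₂)
open import Data.Sum using (_⊎_; inj₁; inj₂)
open import Relation.Nullary using (¬_)
open import Relation.Binary.PropositionalEquality using (_≡_; _≢_; refl)
open import Algebra.Bundles using (CommutativeRing)

record Field (c ℓ : Level) : Set (lsuc (c ⊔ ℓ)) where
  field
    commRing : CommutativeRing c ℓ
  open CommutativeRing commRing public
  field
    0≉1      : ¬ (0# ≈ 1#)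
    inverse  : ∀ x → ¬ (x ≈ 0#) → Σ Carrier λ y → (x * y) ≈ 1#

-- Linear algebra in the standard space k^n (every finite-dimensional
-- k-vector space is isomorphic to some k^n).

module LinAlg {c ℓ : Level} (F : Field c ℓ) where
  open Field F

  Vec : ℕ → Set c
  Vec n = Fin n → Carrier

  _≋_ : ∀ {n} → Vec n → Vec n → Set ℓ
  u ≋ v = ∀ k → u k ≈ v k

  𝟎 : ∀ {n} → Vec n
  𝟎 _ = 0#

  _⊕ᵥ_ : ∀ {n} → Vec n → Vec n → Vec n
  (u ⊕ᵥ v) k = u k + v k

  _·_ : ∀ {n} → Carrier → Vec n → Vec n
  (a · v) k = a * v k

  record Subspace (n : ℕ) : Set (lsuc (c ⊔ ℓ)) where
    field
      _∈W      : Vec n → Set (c ⊔ ℓ)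
      resp     : ∀ {u v} → u ≋ v → u ∈W → v ∈W
      zero∈    : 𝟎 ∈W
      add∈     : ∀ {u v} → u ∈W → v ∈W → (u ⊕ᵥ v) ∈W
      scale∈   : ∀ a {v} → v ∈W → (a · v) ∈W
  open Subspace public

  module _ {n : ℕ} where
    _⊆_ : Subspace n → Subspace n → Set (c ⊔ ℓ)
    U ⊆ U' = ∀ v → _∈W U v → _∈W U' v

    _≐_ : Subspace n → Subspace n → Set (c ⊔ ℓ)
    U ≐ U' = (U ⊆ U') × (U' ⊆ U)

    _⊊_ : Subspace n → Subspace n → Set (c ⊔ ℓ)
    U ⊊ U' = (U ⊆ U') × ¬ (U' ⊆ U)

    NonZeroSub : Subspace n → Set (c ⊔ ℓ)
    NonZeroSub U = Σ (Vec n) λ v → _∈W U v × ¬ (v ≋ 𝟎)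

    ProperSub : Subspace n → Set (c ⊔ ℓ)
    ProperSub U = Σ (Vec n) λ v → ¬ (_∈W U v)

    InSum : Subspace n → Subspace n → Vec n → Set (c ⊔ ℓ)
    InSum Y Z v = Σ (Vec n) λ a → Σ (Vec n) λ b →
                    _∈W Y a × _∈W Z b × (v ≋ (a ⊕ᵥ b))

    DirectSumEq : Subspace n → Subspace n → Subspace n → Set (c ⊔ ℓ)
    DirectSumEq Y Z U =
      (∀ v → _∈W Y v → _∈W Z v → v ≋ 𝟎) ×
      ((∀ v → _∈W U v → InSum Y Z v) × (∀ v → InSum Y Z v → _∈W U v))

    DirectSumWhole : Subspace n → Subspace n → Set (c ⊔ ℓ)
    DirectSumWhole Y Z =
      (∀ v → _∈W Y v → _∈W Z v → v ≋ 𝟎) × (∀ v → InSum Y Z v)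

    -- For X ⊆ Y, Z: (Y/X) ⊕ (Z/X) = k^n/X, i.e. Y ∩ Z = X and Y + Z = k^n.
    QuotDirectSumWhole : Subspace n → Subspace n → Subspace n → Set (c ⊔ ℓ)
    QuotDirectSumWhole X Y Z =
      ((∀ v → _∈W Y v → _∈W Z v → _∈W X v) × (∀ v → _∈W X v → _∈W Y v × _∈W Z v))
      × (∀ v → InSum Y Z v)

module Building {c ℓ : Level} (F : Field c ℓ) where
  open LinAlg F public

  record Vertex₁ (n : ℕ) : Set (lsuc (c ⊔ ℓ)) where
    constructor vtx
    field
      sub      : Subspace n
      nonzero  : NonZeroSub sub
      proper   : ProperSub sub
  open Vertex₁ public

  module _ {n : ℕ} where
    Adj₁ : Vertex₁ n → Vertex₁ n → Set (c ⊔ ℓ)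
    Adj₁ y z = ((sub y ⊆ sub z) ⊎ (sub z ⊆ sub y)) × ¬ (sub y ≐ sub z)

    Opp₁ : Vertex₁ n → Vertex₁ n → Set (c ⊔ ℓ)
    Opp₁ y z = DirectSumWhole (sub y) (sub z)

    -- y, z opposite in the link of x = x_X in B(k^n), the link being the
    -- join B(X) * B(k^n/X): either both lie in B(X) and Y ⊕ Z = X, or both
    -- lie in B(k^n/X) and (Y/X) ⊕ (Z/X) = k^n/X.
    OppLink₁ : Vertex₁ n → Vertex₁ n → Vertex₁ n → Set (c ⊔ ℓ)
    OppLink₁ x y z =
      ((sub y ⊊ sub x) × (sub z ⊊ sub x) × DirectSumEq (sub y) (sub z) (sub x))
      ⊎
      ((sub x ⊊ sub y) × (sub x ⊊ sub z) × QuotDirectSumWhole (sub x) (sub y) (sub z))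

  -- geodesic path (x_0, ..., x_{m+1}) in B(k^n), length l = m + 1 ≥ 1
  IsGeodesic₁ : ∀ {n} (m : ℕ) → (Fin (suc (suc m)) → Vertex₁ n) → Set (c ⊔ ℓ)
  IsGeodesic₁ m x =
    (∀ (t : Fin (suc m)) → Adj₁ (x (inject₁ t)) (x (suc t))) ×
    (∀ (t : Fin m) → OppLink₁ (x (suc (inject₁ t)))
                              (x (inject₁ (inject₁ t))) (x (suc (suc t))))

  module Join {r : ℕ} (dim : Fin r → ℕ) where
    tr : ∀ {i j} → i ≡ j → Vertex₁ (dim i) → Vertex₁ (dim j)
    tr refl v = v

    record Vertex : Set (lsuc (c ⊔ ℓ)) where
      constructor at
      field
        factor : Fin r
        vert   : Vertex₁ (dim factor)
    open Vertex public

    Adj : Vertex → Vertex → Set (c ⊔ ℓ)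
    Adj x y = (factor x ≢ factor y)
            ⊎ (Σ (factor x ≡ factor y) λ e → Adj₁ (tr e (vert x)) (vert y))

    -- y, z opposite in the link of x (join of the B(V_j), j ≠ i, with
    -- B(W) and B(V_i/W), with join opposition)
    OppLink : Vertex → Vertex → Vertex → Set (c ⊔ ℓ)
    OppLink x y z =
      (Σ (factor y ≡ factor x) λ e₁ → Σ (factor z ≡ factor x) λ e₂ →
          OppLink₁ (vert x) (tr e₁ (vert y)) (tr e₂ (vert z)))
      ⊎
      ((factor y ≢ factor x) × (Σ (factor y ≡ factor z) λ e →
          Opp₁ (tr e (vert y)) (vert z)))

    IsGeodesic : (m : ℕ) → (Fin (suc (suc m)) → Vertex) → Set (c ⊔ ℓ)
    IsGeodesic m x =
      (∀ (t : Fin (suc m)) → Adj (x (inject₁ t)) (x (suc t))) ×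
      (∀ (t : Fin m) → OppLink (x (suc (inject₁ t)))
                               (x (inject₁ (inject₁ t))) (x (suc (suc t))))

    Case1 : (m : ℕ) → (Fin (suc (suc m)) → Vertex) → Set (c ⊔ ℓ)
    Case1 m x = Σ (Fin r) λ i → Σ (∀ s → factor (x s) ≡ i) λ e →
                  IsGeodesic₁ m (λ s → tr (e s) (vert (x s)))

    Case2 : (m : ℕ) → (Fin (suc (suc m)) → Vertex) → Set (c ⊔ ℓ)
    Case2 m x = Σ (Fin r) λ i → Σ (Fin r) λ j → (i ≢ j) ×
      ((∀ s → (factor (x s) ≡ i) ⊎ (factor (x s) ≡ j)) ×
       (∀ (t : Fin (suc m)) → factor (x (inject₁ t)) ≢ factor (x (suc t))) ×
       (∀ (t : Fin m) →
          (∀ (e₁ : factor (x (inject₁ (inject₁ t))) ≡ i)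
             (e₂ : factor (x (suc (suc t))) ≡ i) →
             Opp₁ (tr e₁ (vert (x (inject₁ (inject₁ t))))) (tr e₂ (vert (x (suc (suc t)))))) ×
          (∀ (e₁ : factor (x (inject₁ (inject₁ t))) ≡ j)
             (e₂ : factor (x (suc (suc t))) ≡ j) →
             Opp₁ (tr e₁ (vert (x (inject₁ (inject₁ t))))) (tr e₂ (vert (x (suc (suc t))))))))

{-# OPTIONS --safe #-}
module Submission where

-- Geodesicity is a condition on consecutive triples. At an interior vertex x_s lying in V_i, the
-- link is the join of B(W_s), B(V_i/W_s) and the other factors, so x_{s-1}, x_{s+1} are opposite
-- there exactly when either all three vertices lie in V_i and are opposite in the link of x_s in
-- B(V_i), or x_{s-1}, x_{s+1} lie in a common factor V_j ≠ V_i and are opposite in B(V_j).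
-- Hence the factor sequence of a geodesic either stays constant (if it starts constant) or
-- alternates between two factors, which gives the two cases.

open import Defs
open import Level using (Level)
open import Data.Nat using (ℕ; zero; suc)
open import Data.Fin using (Fin; zero; suc; inject₁; _≟_)
open import Data.Sum using (_⊎_; inj₁; inj₂; [_,_]′)
open import Data.Product using (_×_; _,_; proj₁; proj₂; map)
open import Data.Empty using (⊥-elim)
open import Function.Bundles using (_⇔_; mk⇔; Equivalence)
open import Relation.Nullary using (yes; no)
open import Relation.Binary.PropositionalEquality using (_≡_; _≢_; refl; sym; trans)

open Equivalence using (to; from)

module _ {a} {A : Set a} where

  propagate-constant : ∀ m (g : Fin (suc (suc m)) → A) → g zero ≡ g (suc zero) →
    (∀ (t : Fin m) → g (inject₁ (inject₁ t)) ≡ g (suc (inject₁ t)) →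
                     g (suc (suc t)) ≡ g (suc (inject₁ t))) →
    ∀ s → g s ≡ g zero
  propagate-constant m       g g₀≡g₁ step zero = refl
  propagate-constant zero    g g₀≡g₁ step (suc zero) = sym g₀≡g₁
  propagate-constant (suc m) g g₀≡g₁ step (suc s) =
    trans (propagate-constant m (λ u → g (suc u)) (sym (step zero g₀≡g₁)) (λ t → step (suc t)) s)
          (sym g₀≡g₁)

  propagate-alternation : ∀ m (g : Fin (suc (suc m)) → A) → g zero ≢ g (suc zero) →
    (∀ (t : Fin m) → g (inject₁ (inject₁ t)) ≢ g (suc (inject₁ t)) →
                     g (inject₁ (inject₁ t)) ≡ g (suc (suc t))) →
    (∀ (t : Fin (suc m)) → g (inject₁ t) ≢ g (suc t)) ×
    (∀ s → (g s ≡ g zero) ⊎ (g s ≡ g (suc zero)))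
  propagate-alternation zero g g₀≢g₁ step =
    (λ { zero → g₀≢g₁ }) , λ { zero → inj₁ refl ; (suc zero) → inj₂ refl }
  propagate-alternation (suc m) g g₀≢g₁ step =
    (λ { zero → g₀≢g₁ ; (suc t) → proj₁ tail t }) ,
    λ { zero → inj₁ refl ; (suc s) → [ inj₂ , (λ e → inj₁ (trans e (sym g₀≡g₂))) ]′ (proj₂ tail s) }
    where
    g₀≡g₂ : g zero ≡ g (suc (suc zero))
    g₀≡g₂ = step zero g₀≢g₁
    tail = propagate-alternation m (λ u → g (suc u)) (λ e → g₀≢g₁ (trans g₀≡g₂ (sym e)))
                                 (λ t → step (suc t))

  two-valued-≢-≢⇒≡ : ∀ {i j a b d : A} → (a ≡ i) ⊎ (a ≡ j) → (b ≡ i) ⊎ (b ≡ j) →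
    (d ≡ i) ⊎ (d ≡ j) → a ≢ b → b ≢ d → a ≡ d
  two-valued-≢-≢⇒≡ (inj₁ refl) (inj₁ refl) _           a≢b _   = ⊥-elim (a≢b refl)
  two-valued-≢-≢⇒≡ (inj₂ refl) (inj₂ refl) _           a≢b _   = ⊥-elim (a≢b refl)
  two-valued-≢-≢⇒≡ (inj₁ refl) (inj₂ refl) (inj₁ refl) _   _   = refl
  two-valued-≢-≢⇒≡ (inj₂ refl) (inj₁ refl) (inj₂ refl) _   _   = refl
  two-valued-≢-≢⇒≡ (inj₁ refl) (inj₂ refl) (inj₂ refl) _   b≢d = ⊥-elim (b≢d refl)
  two-valued-≢-≢⇒≡ (inj₂ refl) (inj₁ refl) (inj₁ refl) _   b≢d = ⊥-elim (b≢d refl)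

module JoinGeodesics {c ℓ : Level} (F : Field c ℓ) {r : ℕ} (dim : Fin r → ℕ) where
  open Building F
  open Join dim

  Adj-within-factor : ∀ {x y i} (ex : factor x ≡ i) (ey : factor y ≡ i) →
    Adj x y ⇔ Adj₁ (tr ex (vert x)) (tr ey (vert y))
  Adj-within-factor {at a v} {at .a w} refl refl = mk⇔ within (λ p → inj₂ (refl , p))
    where
    within : Adj (at a v) (at a w) → Adj₁ v w
    within (inj₁ a≢a)       = ⊥-elim (a≢a refl)
    within (inj₂ (refl , p)) = p

  OppLink-within-factor : ∀ x y z {i} (ex : factor x ≡ i) (ey : factor y ≡ i) (ez : factor z ≡ i) →
    OppLink x y z ⇔ OppLink₁ (tr ex (vert x)) (tr ey (vert y)) (tr ez (vert z))
  OppLink-within-factor (at a u) (at .a v) (at .a w) refl refl refl =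
    mk⇔ within (λ p → inj₁ (refl , refl , p))
    where
    within : OppLink (at a u) (at a v) (at a w) → OppLink₁ u v w
    within (inj₁ (refl , refl , p)) = p
    within (inj₂ (a≢a , _))         = ⊥-elim (a≢a refl)

  OppLink-across-factors : ∀ x y z {i} → factor y ≢ factor x →
    (ey : factor y ≡ i) (ez : factor z ≡ i) →
    OppLink x y z ⇔ Opp₁ (tr ey (vert y)) (tr ez (vert z))
  OppLink-across-factors (at a u) (at b v) (at .b w) b≢a refl refl =
    mk⇔ across (λ p → inj₂ (b≢a , refl , p))
    where
    across : OppLink (at a u) (at b v) (at b w) → Opp₁ v w
    across (inj₁ (b≡a , _))         = ⊥-elim (b≢a b≡a)
    across (inj₂ (_ , refl , p))    = p

  OppLink-stays-in-factor : ∀ x y z → OppLink x y z → factor y ≡ factor x → factor z ≡ factor x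
  OppLink-stays-in-factor _ _ _ (inj₁ (_ , z≡x , _)) _   = z≡x
  OppLink-stays-in-factor _ _ _ (inj₂ (y≢x , _))     y≡x = ⊥-elim (y≢x y≡x)

  OppLink-returns-to-factor : ∀ x y z → OppLink x y z → factor y ≢ factor x → factor y ≡ factor z
  OppLink-returns-to-factor _ _ _ (inj₁ (y≡x , _))     y≢x = ⊥-elim (y≢x y≡x)
  OppLink-returns-to-factor _ _ _ (inj₂ (_ , y≡z , _)) _   = y≡z

  module _ (m : ℕ) (x : Fin (suc (suc m)) → Vertex) where
    left mid right : Fin m → Vertex
    left  t = x (inject₁ (inject₁ t))
    mid   t = x (suc (inject₁ t))
    right t = x (suc (suc t))

    geodesic-within-factor : ∀ {i} (e : ∀ s → factor (x s) ≡ i) →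
      IsGeodesic m x ⇔ IsGeodesic₁ m (λ s → tr (e s) (vert (x s)))
    geodesic-within-factor e = mk⇔
      (map (λ adj t → to (adj-iff t) (adj t)) (λ opp t → to (opp-iff t) (opp t)))
      (map (λ adj t → from (adj-iff t) (adj t)) (λ opp t → from (opp-iff t) (opp t)))
      where
      adj-iff = λ (t : Fin (suc m)) → Adj-within-factor (e (inject₁ t)) (e (suc t))
      opp-iff = λ (t : Fin m) → OppLink-within-factor (mid t) (left t) (right t)
                                  (e (suc (inject₁ t))) (e (inject₁ (inject₁ t))) (e (suc (suc t)))

    geodesic-stays-in-factor : IsGeodesic m x → ∀ t →
      factor (left t) ≡ factor (mid t) → factor (right t) ≡ factor (mid t)
    geodesic-stays-in-factor (_ , opp) t = OppLink-stays-in-factor (mid t) (left t) (right t) (opp t)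

    geodesic-returns-to-factor : IsGeodesic m x → ∀ t →
      factor (left t) ≢ factor (mid t) → factor (left t) ≡ factor (right t)
    geodesic-returns-to-factor (_ , opp) t = OppLink-returns-to-factor (mid t) (left t) (right t) (opp t)

    geodesic⇒Case1⊎Case2 : IsGeodesic m x → Case1 m x ⊎ Case2 m x
    geodesic⇒Case1⊎Case2 geo with factor (x zero) ≟ factor (x (suc zero))
    ... | yes f₀≡f₁ = inj₁ (factor (x zero) , constant , to (geodesic-within-factor constant) geo)
      where
      constant : ∀ s → factor (x s) ≡ factor (x zero)
      constant = propagate-constant m (λ s → factor (x s)) f₀≡f₁ (geodesic-stays-in-factor geo)
    ... | no f₀≢f₁ = inj₂ (factor (x zero) , factor (x (suc zero)) , f₀≢f₁ ,
                           proj₂ alternation , alternating , λ t → opposite t , opposite t)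
      where
      alternation = propagate-alternation m (λ s → factor (x s)) f₀≢f₁
                                          (geodesic-returns-to-factor geo)
      alternating : ∀ (t : Fin (suc m)) → factor (x (inject₁ t)) ≢ factor (x (suc t))
      alternating = proj₁ alternation
      opposite : ∀ t {k} (e₁ : factor (left t) ≡ k) (e₂ : factor (right t) ≡ k) →
        Opp₁ (tr e₁ (vert (left t))) (tr e₂ (vert (right t)))
      opposite t e₁ e₂ =
        to (OppLink-across-factors (mid t) (left t) (right t) (alternating (inject₁ t)) e₁ e₂)
           (proj₂ geo t)

    Case1⇒geodesic : Case1 m x → IsGeodesic m x
    Case1⇒geodesic (_ , constant , geo₁) = from (geodesic-within-factor constant) geo₁

    Case2⇒geodesic : Case2 m x → IsGeodesic m x
    Case2⇒geodesic (_ , _ , _ , two-valued , alternating , opposite) =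
      (λ t → inj₁ (alternating t)) , opp
      where
      opp : ∀ t → OppLink (mid t) (left t) (right t)
      opp t = [ (λ e → from (iff e (trans (sym returns) e)) (proj₁ (opposite t) e _))
              , (λ e → from (iff e (trans (sym returns) e)) (proj₂ (opposite t) e _)) ]′
              (two-valued (inject₁ (inject₁ t)))
        where
        iff : ∀ {k} (e₁ : factor (left t) ≡ k) (e₂ : factor (right t) ≡ k) →
          OppLink (mid t) (left t) (right t) ⇔ Opp₁ (tr e₁ (vert (left t))) (tr e₂ (vert (right t)))
        iff = OppLink-across-factors (mid t) (left t) (right t) (alternating (inject₁ t))
        returns : factor (left t) ≡ factor (right t)
        returns = two-valued-≢-≢⇒≡ (two-valued _) (two-valued _) (two-valued _)
                                   (alternating (inject₁ t)) (alternating (suc t))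

proposition1p2p5 : ∀ {c ℓ : Level} (F : Field c ℓ) (r : ℕ) (dim : Fin r → ℕ)
    (m : ℕ) (x : Fin (suc (suc m)) → Building.Join.Vertex F dim) →
    Building.Join.IsGeodesic F dim m x
      ⇔ (Building.Join.Case1 F dim m x ⊎ Building.Join.Case2 F dim m x)
proposition1p2p5 F r dim m x =
  mk⇔ (geodesic⇒Case1⊎Case2 m x) [ Case1⇒geodesic m x , Case2⇒geodesic m x ]′
  where open JoinGeodesics F dim
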